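{- For $n\ge1$, let $\boldsymbol\sigma_n$ be a uniformly random 231-avoiding permutation of size $n$, and write $\boldsymbol\sigma_n=\boldsymbol\tau_n\oplus(1\ominus\boldsymbol\pi_n)$ for its unique decomposition with $\boldsymbol\tau_n,\boldsymbol\pi_n$ (possibly empty) 231-avoiding permutations. Then for every fixed 231-avoiding permutation $\rho$, $$\lim_{n\to\infty}\mathbb P(\boldsymbol\tau_n=\rho)=\lim_{n\to\infty}\mathbb P(\boldsymbol\pi_n=\rho)=4^{ -|\rho|-1},$$ where $|\rho|$ is the size of $\rho$.
   Context: The direct sum $\tau\oplus\pi$ of permutations is obtained by concatenating their one-line notations and increasing all values of $\pi$ by $|\tau|$; the skew sum $\tau\ominus\pi$ is obtained by concatenation, increasing all values of $\tau$ by $|\pi|$; $1$ is the permutation of size one. Every nonempty 231-avoiding permutation $\sigma$ can be written uniquely as $\tau\oplus(1\ominus\pi)$ with $\tau,\pi$ 231-avoiding (possibly empty). -}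

module Defs where

open import Data.Bool using (Bool; true; false; _∧_; not; if_then_else_)
open import Data.Nat using (ℕ; zero; suc; _+_; _^_; _<ᵇ_; _≡ᵇ_; _≤_)
open import Data.List using (List; []; _∷_; _++_; map; concatMap; upTo; length; filterᵇ)
open import Data.Bool.ListAction using (all; any)
open import Data.List.Properties using (≡-dec)
open import Data.Product using (_×_; _,_; ∃)
open import Data.Integer using (+_)
open import Data.Rational using (ℚ; 0ℚ; _/_; _-_; ∣_∣; _<_)
open import Relation.Nullary.Decidable using (⌊_⌋)
import Data.Nat as ℕ

-- Permutations are given in one-line notation as lists of naturals,
-- a permutation of size n being a list containing each of 1..n exactly once.

lists : ℕ → ℕ → List (List ℕ)
lists n zero = [] ∷ []
lists n (suc m) = concatMap (λ v → map (v ∷_) (lists n m)) (map suc (upTo n))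

memᵇ : ℕ → List ℕ → Bool
memᵇ x [] = false
memᵇ x (y ∷ l) = if x ≡ᵇ y then true else memᵇ x l

distinct : List ℕ → Bool
distinct [] = true
distinct (x ∷ l) = not (memᵇ x l) ∧ distinct l

pairs : List ℕ → List (ℕ × ℕ)
pairs [] = []
pairs (b ∷ l) = map (b ,_) l ++ pairs l

triples : List ℕ → List (ℕ × ℕ × ℕ)
triples [] = []
triples (a ∷ l) = map (λ { (b , c) → a , b , c }) (pairs l) ++ triples l

avoids231 : List ℕ → Bool
avoids231 σ = all (λ { (a , b , c) → not ((c <ᵇ a) ∧ (a <ᵇ b)) }) (triples σ)

Av : ℕ → List (List ℕ)
Av n = filterᵇ (λ σ → distinct σ ∧ avoids231 σ) (lists n n)

AvUpTo : ℕ → List (List ℕ)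
AvUpTo n = concatMap Av (upTo (suc n))

_⊕_ : List ℕ → List ℕ → List ℕ
τ ⊕ π = τ ++ map (λ x → length τ + x) π

_⊖_ : List ℕ → List ℕ → List ℕ
τ ⊖ π = map (λ x → length π + x) τ ++ π

one : List ℕ
one = 1 ∷ []

infixr 6 _⊕_
infixr 7 _⊖_

_==_ : List ℕ → List ℕ → Bool
σ == σ' = ⌊ ≡-dec ℕ._≟_ σ σ' ⌋

-- event τ(σ) = ρ, where σ = τ ⊕ (1 ⊖ π) with π 231-avoiding (π has size < |σ|)
tauIs : List ℕ → List ℕ → Bool
tauIs ρ σ = any (λ π → σ == (ρ ⊕ (one ⊖ π))) (AvUpTo (length σ))

piIs : List ℕ → List ℕ → Bool
piIs ρ σ = any (λ τ → σ == (τ ⊕ (one ⊖ ρ))) (AvUpTo (length σ))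

ratio : ℕ → ℕ → ℚ
ratio a zero = 0ℚ
ratio a (suc b) = (+ a) / suc b

prob : (List ℕ → Bool) → ℕ → ℚ
prob E n = ratio (length (filterᵇ E (Av n))) (length (Av n))

fourInv : ℕ → ℚ
fourInv m = ratio 1 (4 ^ m)

_⟶_ : (ℕ → ℚ) → ℚ → Set
a ⟶ L = ∀ (ε : ℚ) → 0ℚ < ε → ∃ λ N → ∀ n → N ≤ n → ∣ a n - L ∣ < ε

-- Let c n be the number of 231-avoiding permutations of size n. Splitting σ at its maximum,
-- σ ↦ (τ , π) is a bijection from Av (n + 1) onto the pairs in Av a × Av b with a + b = n,
-- so c obeys the Catalan recursion c (n + 1) = Σ c a · c b; and for fixed ρ ∈ Av k the
-- permutations of size k + 1 + m with τ = ρ (or with π = ρ) are in bijection with Av m.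
-- Both probabilities are therefore c m / c (k + 1 + m).  From the recursion alone, the
-- convolution powers of c are ballot numbers, which gives (n + 2) c (n + 1) = (4n + 2) c n;
-- iterating, 4^j c m (1 - 2j/(m + 2)) ≤ c (j + m) ≤ 4^j c m, so c m / c (j + m) → 4^-j.
module Submission where

open import Defs
open import Data.Nat using (ℕ; suc)
open import Data.List using (List; length)
open import Data.List.Membership.Propositional using (_∈_)
open import Data.Product using (_×_)

open import Function using (_∘_; Equivalence)
open import Data.Bool using (Bool; true; false; T; not; _∧_)
open import Data.Bool.ListAction using (any)
open import Data.Bool.Properties using (T?; T-∧)
open import Data.Nat
open import Data.Nat.Properties
open import Data.Nat.Tactic.RingSolver using (solve-∀)
open import Algebra.Properties.CommutativeSemigroup +-commutativeSemigroup
  using () renaming (interchange to +-interchange)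
open import Algebra.Properties.CommutativeSemigroup *-commutativeSemigroup using (x∙yz≈y∙xz)
open import Data.List using ([]; _∷_; _++_; map; upTo; filterᵇ; concatMap; cartesianProduct; cartesianProductWith)
open import Data.List.Properties using (length-++; length-map; length-upTo; ∷-injective; ∷-injectiveˡ; ∷-injectiveʳ; map-injective; ≡-dec)
open import Data.List.Membership.Propositional using (_∉_; find; lose)
open import Data.List.Membership.Propositional.Properties
open import Data.List.Membership.DecPropositional _≟_ using (_∈?_)
open import Data.List.Relation.Unary.Any using (here; there)
import Data.List.Relation.Unary.Any.Properties as Any
open import Data.List.Relation.Unary.All as All using (All; []; _∷_)
import Data.List.Relation.Unary.All.Properties as All
open import Data.List.Relation.Unary.AllPairs as AllPairs using ([]; _∷_)
open import Data.List.Relation.Unary.Unique.Propositional using (Unique)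
import Data.List.Relation.Unary.Unique.Propositional.Properties as Unique
open import Data.Product using (_,_; ∃; ∃₂; proj₁; proj₂)
open import Data.Sum using (_⊎_; inj₁; inj₂)
open import Data.Empty using (⊥-elim)
open import Relation.Nullary using (¬_; yes; no)
open import Relation.Nullary.Decidable using (toWitness; fromWitness)
open import Relation.Binary.PropositionalEquality
import Data.Integer as ℤ
import Data.Integer.Properties as ℤ
open import Data.Rational as ℚ using (ℚ; mkℚ; 0ℚ; toℚᵘ)
import Data.Rational.Properties as ℚ
import Data.Rational.Unnormalised as ℚᵘ
import Data.Rational.Unnormalised.Properties as ℚᵘ

infixl 7 _⋆_

_⋆_ : (ℕ → ℕ) → (ℕ → ℕ) → ℕ → ℕ
(a ⋆ b) zero    = a 0 * b 0
(a ⋆ b) (suc n) = a 0 * b (suc n) + ((a ∘ suc) ⋆ b) n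

⋆-congˡ : ∀ {a a′} b → a ≗ a′ → a ⋆ b ≗ a′ ⋆ b
⋆-congˡ b a≗a′ zero    = cong (_* b 0) (a≗a′ 0)
⋆-congˡ b a≗a′ (suc n) = cong₂ _+_ (cong (_* b (suc n)) (a≗a′ 0)) (⋆-congˡ b (a≗a′ ∘ suc) n)

*-⋆-assoc : ∀ k a b → (λ i → k * a i) ⋆ b ≗ λ n → k * (a ⋆ b) n
*-⋆-assoc k a b zero    = *-assoc k (a 0) (b 0)
*-⋆-assoc k a b (suc n) = begin
  k * a 0 * b (suc n) + ((λ i → k * a (suc i)) ⋆ b) n
    ≡⟨ cong₂ _+_ (*-assoc k (a 0) (b (suc n))) (*-⋆-assoc k (a ∘ suc) b n) ⟩
  k * (a 0 * b (suc n)) + k * ((a ∘ suc) ⋆ b) n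
    ≡⟨ *-distribˡ-+ k _ _ ⟨
  k * (a ⋆ b) (suc n) ∎
  where open ≡-Reasoning

⋆-distribʳ-+ : ∀ a a′ b → (λ i → a i + a′ i) ⋆ b ≗ λ n → (a ⋆ b) n + (a′ ⋆ b) n
⋆-distribʳ-+ a a′ b zero    = *-distribʳ-+ (b 0) (a 0) (a′ 0)
⋆-distribʳ-+ a a′ b (suc n) = begin
  (a 0 + a′ 0) * b (suc n) + ((λ i → a (suc i) + a′ (suc i)) ⋆ b) n
    ≡⟨ cong₂ _+_ (*-distribʳ-+ (b (suc n)) (a 0) (a′ 0)) (⋆-distribʳ-+ (a ∘ suc) (a′ ∘ suc) b n) ⟩
  (x + x′) + (y + y′)
    ≡⟨ +-interchange x x′ y y′ ⟩
  (x + y) + (x′ + y′) ∎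
  where
  open ≡-Reasoning
  x = a 0 * b (suc n)
  x′ = a′ 0 * b (suc n)
  y = ((a ∘ suc) ⋆ b) n
  y′ = ((a′ ∘ suc) ⋆ b) n

⋆-assoc : ∀ a b d → (a ⋆ b) ⋆ d ≗ a ⋆ (b ⋆ d)
⋆-assoc a b d zero    = *-assoc (a 0) (b 0) (d 0)
⋆-assoc a b d (suc n) = begin
  a 0 * b 0 * d (suc n) + ((λ m → a 0 * b (suc m) + ((a ∘ suc) ⋆ b) m) ⋆ d) n
    ≡⟨ cong (a 0 * b 0 * d (suc n) +_) (⋆-distribʳ-+ (λ m → a 0 * b (suc m)) ((a ∘ suc) ⋆ b) d n) ⟩
  a 0 * b 0 * d (suc n) + (((λ m → a 0 * b (suc m)) ⋆ d) n + (((a ∘ suc) ⋆ b) ⋆ d) n)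
    ≡⟨ cong₂ (λ u v → a 0 * b 0 * d (suc n) + (u + v)) (*-⋆-assoc (a 0) (b ∘ suc) d n) (⋆-assoc (a ∘ suc) b d n) ⟩
  a 0 * b 0 * d (suc n) + (a 0 * ((b ∘ suc) ⋆ d) n + ((a ∘ suc) ⋆ (b ⋆ d)) n)
    ≡⟨ factor (a 0) (b 0) (d (suc n)) (((b ∘ suc) ⋆ d) n) (((a ∘ suc) ⋆ (b ⋆ d)) n) ⟩
  a 0 * (b 0 * d (suc n) + ((b ∘ suc) ⋆ d) n) + ((a ∘ suc) ⋆ (b ⋆ d)) n ∎
  where
  open ≡-Reasoning
  factor : ∀ x y z u v → x * y * z + (x * u + v) ≡ x * (y * z + u) + v
  factor = solve-∀

δ : ℕ → ℕ
δ zero    = 1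
δ (suc n) = 0

⋆-identityʳ : ∀ a → a ⋆ δ ≗ a
⋆-identityʳ a zero    = *-identityʳ (a 0)
⋆-identityʳ a (suc n) = trans (cong (_+ ((a ∘ suc) ⋆ δ) n) (*-zeroʳ (a 0))) (⋆-identityʳ (a ∘ suc) n)

infixl 7 _choose_

_choose_ : ℕ → ℕ → ℕ
n     choose zero  = 1
zero  choose suc k = 0
suc n choose suc k = n choose k + n choose suc k

choose-1 : ∀ m → m choose 1 ≡ m
choose-1 zero    = refl
choose-1 (suc m) = cong suc (choose-1 m)

suc-*-choose-suc : ∀ m k → suc k * (suc m choose suc k) ≡ suc m * (m choose k)
suc-*-choose-suc zero    zero    = refl
suc-*-choose-suc zero    (suc k) = *-zeroʳ (suc (suc k))
suc-*-choose-suc (suc m) zero    = cong suc (trans (+-identityʳ _) (trans (cong suc (choose-1 m)) (sym (*-identityʳ (suc m)))))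
suc-*-choose-suc (suc m) (suc k) = begin
  suc (suc k) * (y + z)
    ≡⟨ expand k y z ⟩
  suc k * y + y + suc (suc k) * z
    ≡⟨ cong₂ (λ u v → u + y + v) (suc-*-choose-suc m k) (suc-*-choose-suc m (suc k)) ⟩
  suc m * (m choose k) + y + suc m * (m choose suc k)
    ≡⟨ collect m (m choose k) (m choose suc k) ⟩
  suc (suc m) * y ∎
  where
  expand : ∀ k u v → suc (suc k) * (u + v) ≡ suc k * u + u + suc (suc k) * v
  expand = solve-∀
  collect : ∀ m u v → suc m * u + (u + v) + suc m * v ≡ suc (suc m) * (u + v)
  collect = solve-∀
  open ≡-Reasoning
  y = suc m choose suc k
  z = suc m choose suc (suc k)

choose-absorb : ∀ m k → suc k * (m choose suc k) + suc k * (m choose k) ≡ suc m * (m choose k)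
choose-absorb zero    zero    = refl
choose-absorb zero    (suc k) = cong₂ _+_ (*-zeroʳ (suc (suc k))) (*-zeroʳ (suc (suc k)))
choose-absorb (suc m) k       = begin
  suc k * (suc m choose suc k) + suc k * (suc m choose k)
    ≡⟨ +-comm (suc k * (suc m choose suc k)) _ ⟩
  suc k * (suc m choose k) + suc k * (suc m choose suc k)
    ≡⟨ *-distribˡ-+ (suc k) (suc m choose k) (suc m choose suc k) ⟨
  suc k * (suc (suc m) choose suc k)
    ≡⟨ suc-*-choose-suc (suc m) k ⟩
  suc (suc m) * (suc m choose k) ∎
  where open ≡-Reasoning

∣a/b-1/d∣<ᵘ : ∀ a b d p q → suc b ≤ a * suc d →
              a * (suc q * suc d) < (suc p * suc d + 1 * suc q) * suc b →
              ℚᵘ.∣ ℚᵘ.mkℚᵘ (ℤ.+ a) b ℚᵘ.- ℚᵘ.mkℚᵘ (ℤ.+ 1) d ∣ ℚᵘ.< ℚᵘ.mkℚᵘ (ℤ.+ suc p) q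
∣a/b-1/d∣<ᵘ a b d p q lower upper = ℚᵘ.<-respˡ-≃ (ℚᵘ.≃-sym ∣x-y∣≃x-y) x-y<ε
  where
  x = ℚᵘ.mkℚᵘ (ℤ.+ a) b
  y = ℚᵘ.mkℚᵘ (ℤ.+ 1) d
  ε = ℚᵘ.mkℚᵘ (ℤ.+ suc p) q
  y≤x : y ℚᵘ.≤ x
  y≤x = ℚᵘ.*≤* (subst₂ ℤ._≤_ (ℤ.pos-* 1 (suc b)) (ℤ.pos-* a (suc d))
          (ℤ.+≤+ (≤-trans (≤-reflexive (+-identityʳ (suc b))) lower)))
  ∣x-y∣≃x-y : ℚᵘ.∣ x ℚᵘ.- y ∣ ℚᵘ.≃ x ℚᵘ.- y
  ∣x-y∣≃x-y = ℚᵘ.0≤p⇒∣p∣≃p (ℚᵘ.p≤q⇒0≤q-p y≤x)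
  x<ε+y : x ℚᵘ.< ε ℚᵘ.+ y
  x<ε+y = ℚᵘ.*<* (subst₂ ℤ._<_ (ℤ.pos-* a (suc q * suc d))
            (trans (ℤ.pos-* (suc p * suc d + 1 * suc q) (suc b))
                   (cong (ℤ._* ℤ.+ suc b) (cong₂ ℤ._+_ (ℤ.pos-* (suc p) (suc d)) (ℤ.pos-* 1 (suc q)))))
            (ℤ.+<+ upper))
  ε+y-y≃ε : (ε ℚᵘ.+ y) ℚᵘ.- y ℚᵘ.≃ ε
  ε+y-y≃ε = ℚᵘ.≃-trans (ℚᵘ.+-assoc ε y (ℚᵘ.- y)) (ℚᵘ.≃-trans (ℚᵘ.+-congʳ ε (ℚᵘ.+-inverseʳ y)) (ℚᵘ.+-identityʳ ε))
  x-y<ε : x ℚᵘ.- y ℚᵘ.< ε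
  x-y<ε = ℚᵘ.<-respʳ-≃ ε+y-y≃ε (ℚᵘ.+-monoˡ-< (ℚᵘ.- y) x<ε+y)

ratio-close : ∀ a B D p q (ε : ℚ) → toℚᵘ ε ≡ ℚᵘ.mkℚᵘ (ℤ.+ suc p) q → 0 < B → 0 < D → B ≤ a * D →
              a * (suc q * D) < (D + suc q) * B → ℚ.∣ ratio a B ℚ.- ratio 1 D ∣ ℚ.< ε
ratio-close a (suc b) (suc d) p q ε ε≡ _ _ B≤aD bound =
  ℚ.toℚᵘ-cancel-< (subst (toℚᵘ ℚ.∣ x ℚ.- y ∣ ℚᵘ.<_) (sym ε≡)
    (ℚᵘ.<-respˡ-≃ (ℚᵘ.≃-sym toℚᵘ-distance) (∣a/b-1/d∣<ᵘ a b d p q B≤aD (<-≤-trans bound weaken))))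
  where
  x = (ℤ.+ a) ℚ./ suc b
  y = (ℤ.+ 1) ℚ./ suc d
  weaken : (suc d + suc q) * suc b ≤ (suc p * suc d + 1 * suc q) * suc b
  weaken = *-monoˡ-≤ (suc b) (+-mono-≤ (m≤n*m (suc d) (suc p)) (≤-reflexive (sym (*-identityˡ (suc q)))))
  toℚᵘ-distance : toℚᵘ ℚ.∣ x ℚ.- y ∣ ℚᵘ.≃ ℚᵘ.∣ ℚᵘ.mkℚᵘ (ℤ.+ a) b ℚᵘ.- ℚᵘ.mkℚᵘ (ℤ.+ 1) d ∣
  toℚᵘ-distance = ℚᵘ.≃-trans (ℚ.toℚᵘ-homo-∣-∣ (x ℚ.- y)) (ℚᵘ.∣-∣-cong
    (ℚᵘ.≃-trans (ℚ.toℚᵘ-homo-+ x (ℚ.- y))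
      (ℚᵘ.+-cong (ℚ.toℚᵘ-fromℚᵘ (ℚᵘ.mkℚᵘ (ℤ.+ a) b))
        (ℚᵘ.≃-trans (ℚ.toℚᵘ-homo‿- y) (ℚᵘ.-‿cong (ℚ.toℚᵘ-fromℚᵘ (ℚᵘ.mkℚᵘ (ℤ.+ 1) d)))))))

toℚᵘ-positive : ∀ ε → 0ℚ ℚ.< ε → ∃₂ λ p q → toℚᵘ ε ≡ ℚᵘ.mkℚᵘ (ℤ.+ suc p) q
toℚᵘ-positive ε 0<ε = from-positive ε (ℚ.positive 0<ε)
  where
  from-positive : ∀ ε → ℚ.Positive ε → ∃₂ λ p q → toℚᵘ ε ≡ ℚᵘ.mkℚᵘ (ℤ.+ suc p) q
  from-positive (mkℚ (ℤ.+ suc p) q _) _ = p , q , refl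

module CatalanRecursion (c : ℕ → ℕ) (c-zero : c 0 ≡ 1) (c-suc : ∀ n → c (suc n) ≡ (c ⋆ c) n) where

  c^⋆ : ℕ → ℕ → ℕ
  c^⋆ zero    = δ
  c^⋆ (suc r) = c ⋆ c^⋆ r

  c^⋆-zero : ∀ r → c^⋆ r 0 ≡ 1
  c^⋆-zero zero    = refl
  c^⋆-zero (suc r) = cong₂ _*_ c-zero (c^⋆-zero r)

  c^⋆-suc : ∀ r n → c^⋆ (suc r) (suc n) ≡ c^⋆ r (suc n) + c^⋆ (suc (suc r)) n
  c^⋆-suc r n = cong₂ _+_ (trans (cong (_* c^⋆ r (suc n)) c-zero) (+-identityʳ _))
                          (trans (⋆-congˡ (c^⋆ r) c-suc n) (⋆-assoc c c (c^⋆ r) n))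

  ballot-step : ∀ n r → let M = suc (suc (n + n + r)) in
                M * c^⋆ r (suc n) ≡ r * (M choose suc n) →
                M * c^⋆ (suc (suc r)) n ≡ suc (suc r) * (M choose n) →
                suc M * c^⋆ (suc r) (suc n) ≡ suc r * (suc M choose suc n)
  ballot-step n r ih₁ ih₂ = *-cancelˡ-≡ _ _ M (begin
    M * (suc M * c^⋆ (suc r) (suc n))
      ≡⟨ cong (λ u → M * (suc M * u)) (c^⋆-suc r n) ⟩
    M * (suc M * (c^⋆ r (suc n) + c^⋆ (suc (suc r)) n))
      ≡⟨ distribute M (c^⋆ r (suc n)) (c^⋆ (suc (suc r)) n) ⟩
    suc M * (M * c^⋆ r (suc n) + M * c^⋆ (suc (suc r)) n)
      ≡⟨ cong₂ (λ u v → suc M * (u + v)) ih₁ ih₂ ⟩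
    suc M * (r * X + suc (suc r) * Y)
      ≡⟨ expand n r X Y ⟩
    Z + 2 * (suc (suc (n + r)) * Y)
      ≡⟨ cong (λ u → Z + 2 * u) pascal-ratio ⟨
    Z + 2 * (suc n * X)
      ≡⟨ collect n r X Y ⟩
    M * (suc r * (Y + X)) ∎)
    where
    open ≡-Reasoning
    M = suc (suc (n + n + r))
    X = M choose suc n
    Y = M choose n
    Z = suc M * r * X + M * suc r * Y
    pascal-ratio : suc n * X ≡ suc (suc (n + r)) * Y
    pascal-ratio = +-cancelʳ-≡ (suc n * Y) _ _ (begin
      suc n * X + suc n * Y             ≡⟨ choose-absorb M n ⟩
      suc M * Y                         ≡⟨ cong (_* Y) (split n r) ⟩
      (suc n + suc (suc (n + r))) * Y   ≡⟨ *-distribʳ-+ Y (suc n) _ ⟩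
      suc n * Y + suc (suc (n + r)) * Y ≡⟨ +-comm (suc n * Y) _ ⟩
      suc (suc (n + r)) * Y + suc n * Y ∎)
      where
      split : ∀ n r → suc (suc (suc (n + n + r))) ≡ suc n + suc (suc (n + r))
      split = solve-∀
    distribute : ∀ M u v → M * (suc M * (u + v)) ≡ suc M * (M * u + M * v)
    distribute = solve-∀
    expand : ∀ n r X Y → let M = suc (suc (n + n + r)) in
             suc M * (r * X + suc (suc r) * Y) ≡ suc M * r * X + M * suc r * Y + 2 * (suc (suc (n + r)) * Y)
    expand = solve-∀
    collect : ∀ n r X Y → let M = suc (suc (n + n + r)) in
              suc M * r * X + M * suc r * Y + 2 * (suc n * X) ≡ M * (suc r * (Y + X))
    collect = solve-∀

  -- the ballot numbers: [xⁿ] C(x)^r = r/(2n+r) · binom(2n+r, n)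
  c^⋆-closed-form : ∀ n r → (n + n + r) * c^⋆ r n ≡ r * ((n + n + r) choose n)
  c^⋆-closed-form zero    r       = cong (r *_) (c^⋆-zero r)
  c^⋆-closed-form (suc n) zero    = *-zeroʳ (suc n + suc n + 0)
  c^⋆-closed-form (suc n) (suc r) =
    subst (λ N → N * c^⋆ (suc r) (suc n) ≡ suc r * (N choose suc n)) (sym (index₀ n r))
      (ballot-step n r
        (subst (λ N → N * c^⋆ r (suc n) ≡ r * (N choose suc n)) (index₁ n r) (c^⋆-closed-form (suc n) r))
        (subst (λ N → N * c^⋆ (suc (suc r)) n ≡ suc (suc r) * (N choose n)) (index₂ n r) (c^⋆-closed-form n (suc (suc r)))))
    where
    index₀ : ∀ n r → suc n + suc n + suc r ≡ suc (suc (suc (n + n + r)))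
    index₀ = solve-∀
    index₁ : ∀ n r → suc n + suc n + r ≡ suc (suc (n + n + r))
    index₁ = solve-∀
    index₂ : ∀ n r → n + n + suc (suc r) ≡ suc (suc (n + n + r))
    index₂ = solve-∀

  catalan-closed-form : ∀ n → suc (n + n) * c n ≡ suc (n + n) choose n
  catalan-closed-form n = subst (λ N → N * c n ≡ N choose n) (+-comm (n + n) 1) (begin
    (n + n + 1) * c n          ≡⟨ cong ((n + n + 1) *_) (⋆-identityʳ c n) ⟨
    (n + n + 1) * c^⋆ 1 n      ≡⟨ c^⋆-closed-form n 1 ⟩
    1 * ((n + n + 1) choose n) ≡⟨ *-identityˡ _ ⟩
    (n + n + 1) choose n       ∎)
    where open ≡-Reasoning

  c-ratio : ∀ n → suc (suc n) * c (suc n) ≡ (2 + 4 * n) * c n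
  c-ratio n = *-cancelˡ-≡ _ _ (suc n * suc (suc (suc (n + n)))) (begin
    suc n * suc (suc (suc (n + n))) * (suc (suc n) * c (suc n))
      ≡⟨ shuffle₁ n (c (suc n)) ⟩
    suc (suc n) * (suc n * (suc (suc (suc (n + n))) * c (suc n)))
      ≡⟨ cong (λ u → suc (suc n) * (suc n * u)) catalan-suc ⟩
    suc (suc n) * (suc n * (suc (suc (suc (n + n))) choose suc n))
      ≡⟨ cong (suc (suc n) *_) (suc-*-choose-suc (suc (suc (n + n))) n) ⟩
    suc (suc n) * (suc (suc (suc (n + n))) * (suc (suc (n + n)) choose n))
      ≡⟨ shuffle₂ n (suc (suc (n + n)) choose n) ⟩
    suc (suc (suc (n + n))) * (suc (suc n) * (suc (suc (n + n)) choose n))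
      ≡⟨ cong (suc (suc (suc (n + n))) *_) central ⟨
    suc (suc (suc (n + n))) * (suc n * (suc (suc (n + n)) choose suc n))
      ≡⟨ cong (suc (suc (suc (n + n))) *_) (suc-*-choose-suc (suc (n + n)) n) ⟩
    suc (suc (suc (n + n))) * (suc (suc (n + n)) * (suc (n + n) choose n))
      ≡⟨ cong (λ u → suc (suc (suc (n + n))) * (suc (suc (n + n)) * u)) (catalan-closed-form n) ⟨
    suc (suc (suc (n + n))) * (suc (suc (n + n)) * (suc (n + n) * c n))
      ≡⟨ shuffle₃ n (c n) ⟩
    suc n * suc (suc (suc (n + n))) * ((2 + 4 * n) * c n) ∎)
    where
    open ≡-Reasoning
    catalan-suc : suc (suc (suc (n + n))) * c (suc n) ≡ suc (suc (suc (n + n))) choose suc n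
    catalan-suc = subst (λ N → suc (suc N) * c (suc n) ≡ suc (suc N) choose suc n) (+-suc n n) (catalan-closed-form (suc n))
    central : suc n * (suc (suc (n + n)) choose suc n) ≡ suc (suc n) * (suc (suc (n + n)) choose n)
    central = +-cancelʳ-≡ (suc n * Y) _ _ (begin
      suc n * (suc (suc (n + n)) choose suc n) + suc n * Y ≡⟨ choose-absorb (suc (suc (n + n))) n ⟩
      suc (suc (suc (n + n))) * Y                          ≡⟨ cong (λ N → suc (suc N) * Y) (+-suc n n) ⟨
      (suc (suc n) + suc n) * Y                            ≡⟨ *-distribʳ-+ Y (suc (suc n)) (suc n) ⟩
      suc (suc n) * Y + suc n * Y                          ∎)
      where Y = suc (suc (n + n)) choose n
    shuffle₁ : ∀ n x → suc n * suc (suc (suc (n + n))) * (suc (suc n) * x) ≡ suc (suc n) * (suc n * (suc (suc (suc (n + n))) * x))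
    shuffle₁ = solve-∀
    shuffle₂ : ∀ n x → suc (suc n) * (suc (suc (suc (n + n))) * x) ≡ suc (suc (suc (n + n))) * (suc (suc n) * x)
    shuffle₂ = solve-∀
    shuffle₃ : ∀ n x → suc (suc (suc (n + n))) * (suc (suc (n + n)) * (suc (n + n) * x)) ≡ suc n * suc (suc (suc (n + n))) * ((2 + 4 * n) * x)
    shuffle₃ = solve-∀

  c-positive : ∀ n → 0 < c n
  c-positive zero    = ≤-reflexive (sym c-zero)
  c-positive (suc n) = *-cancelˡ-< (suc (suc n)) 0 (c (suc n)) (begin-strict
    suc (suc n) * 0         ≡⟨ *-zeroʳ (suc (suc n)) ⟩
    0                       <⟨ c-positive n ⟩
    c n                     ≤⟨ m≤n*m (c n) (2 + 4 * n) ⟩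
    (2 + 4 * n) * c n       ≡⟨ c-ratio n ⟨
    suc (suc n) * c (suc n) ∎)
    where open ≤-Reasoning

  c-mono : ∀ n → c n ≤ c (suc n)
  c-mono n = *-cancelˡ-≤ (suc (suc n)) (begin
    suc (suc n) * c n       ≤⟨ *-monoˡ-≤ (c n) (s≤s (s≤s (m≤n*m n 4))) ⟩
    (2 + 4 * n) * c n       ≡⟨ c-ratio n ⟨
    suc (suc n) * c (suc n) ∎)
    where open ≤-Reasoning

  c-suc≤4*c : ∀ n → c (suc n) ≤ 4 * c n
  c-suc≤4*c n = *-cancelˡ-≤ (suc (suc n)) (begin
    suc (suc n) * c (suc n) ≡⟨ c-ratio n ⟩
    (2 + 4 * n) * c n       ≤⟨ *-monoˡ-≤ (c n) (m≤m+n (2 + 4 * n) 6) ⟩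
    (2 + 4 * n + 6) * c n   ≡⟨ cong (_* c n) (regroup n) ⟩
    suc (suc n) * 4 * c n   ≡⟨ *-assoc (suc (suc n)) 4 (c n) ⟩
    suc (suc n) * (4 * c n) ∎)
    where
    open ≤-Reasoning
    regroup : ∀ n → 2 + 4 * n + 6 ≡ suc (suc n) * 4
    regroup = solve-∀

  c-mono-+ : ∀ j m → c m ≤ c (j + m)
  c-mono-+ zero    m = ≤-refl
  c-mono-+ (suc j) m = ≤-trans (c-mono-+ j m) (c-mono (j + m))

  c-upper : ∀ j m → c (j + m) ≤ 4 ^ j * c m
  c-upper zero    m = ≤-reflexive (sym (+-identityʳ (c m)))
  c-upper (suc j) m = begin
    c (suc (j + m))     ≤⟨ c-suc≤4*c (j + m) ⟩
    4 * c (j + m)       ≤⟨ *-monoʳ-≤ 4 (c-upper j m) ⟩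
    4 * (4 ^ j * c m)   ≡⟨ *-assoc 4 (4 ^ j) (c m) ⟨
    4 ^ suc j * c m     ∎
    where open ≤-Reasoning

  c-suc-lower : ∀ j m → 4 * (suc (suc m) * c (j + m)) ≤ suc (suc m) * c (suc (j + m)) + 8 * (4 ^ j * c m)
  c-suc-lower j m = *-cancelˡ-≤ (suc (suc t)) (begin
    suc (suc t) * (4 * (suc (suc m) * c t))
      ≡⟨ expand t m (c t) ⟩
    suc (suc m) * ((2 + 4 * t) * c t) + 6 * (suc (suc m) * c t)
      ≡⟨ cong (λ u → suc (suc m) * u + 6 * (suc (suc m) * c t)) (c-ratio t) ⟨
    suc (suc m) * (suc (suc t) * c (suc t)) + 6 * (suc (suc m) * c t)
      ≤⟨ +-mono-≤ (≤-reflexive (x∙yz≈y∙xz (suc (suc m)) (suc (suc t)) (c (suc t)))) error ⟩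
    suc (suc t) * (suc (suc m) * c (suc t)) + suc (suc t) * (8 * P)
      ≡⟨ *-distribˡ-+ (suc (suc t)) (suc (suc m) * c (suc t)) (8 * P) ⟨
    suc (suc t) * (suc (suc m) * c (suc t) + 8 * P) ∎)
    where
    open ≤-Reasoning
    t = j + m
    P = 4 ^ j * c m
    expand : ∀ t m x → suc (suc t) * (4 * (suc (suc m) * x)) ≡ suc (suc m) * ((2 + 4 * t) * x) + 6 * (suc (suc m) * x)
    expand = solve-∀
    error : 6 * (suc (suc m) * c t) ≤ suc (suc t) * (8 * P)
    error = begin
      6 * (suc (suc m) * c t) ≤⟨ *-monoʳ-≤ 6 (*-mono-≤ (s≤s (s≤s (m≤n+m m j))) (c-upper j m)) ⟩
      6 * (suc (suc t) * P)   ≤⟨ *-monoˡ-≤ (suc (suc t) * P) (m≤m+n 6 2) ⟩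
      8 * (suc (suc t) * P)   ≡⟨ x∙yz≈y∙xz 8 (suc (suc t)) P ⟩
      suc (suc t) * (8 * P)   ∎

  c-lower : ∀ j m → suc (suc m) * (4 ^ j * c m) ≤ suc (suc m) * c (j + m) + 2 * j * (4 ^ j * c m)
  c-lower zero    m = ≤-reflexive (trans (cong (suc (suc m) *_) (+-identityʳ (c m))) (sym (+-identityʳ _)))
  c-lower (suc j) m = begin
    suc (suc m) * (4 * 4 ^ j * c m)
      ≡⟨ pull-4 (suc (suc m)) (4 ^ j) (c m) ⟩
    4 * (suc (suc m) * P)
      ≤⟨ *-monoʳ-≤ 4 (c-lower j m) ⟩
    4 * (suc (suc m) * c (j + m) + 2 * j * P)
      ≡⟨ distribute (suc (suc m) * c (j + m)) j P ⟩
    4 * (suc (suc m) * c (j + m)) + 8 * j * P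
      ≤⟨ +-monoˡ-≤ (8 * j * P) (c-suc-lower j m) ⟩
    suc (suc m) * c (suc (j + m)) + 8 * P + 8 * j * P
      ≡⟨ regroup (suc (suc m) * c (suc (j + m))) j (4 ^ j) (c m) ⟩
    suc (suc m) * c (suc (j + m)) + 2 * suc j * (4 * 4 ^ j * c m) ∎
    where
    open ≤-Reasoning
    P = 4 ^ j * c m
    pull-4 : ∀ a d x → a * (4 * d * x) ≡ 4 * (a * (d * x))
    pull-4 = solve-∀
    distribute : ∀ u j p → 4 * (u + 2 * j * p) ≡ 4 * u + 8 * j * p
    distribute = solve-∀
    regroup : ∀ u j d x → u + 8 * (d * x) + 8 * j * (d * x) ≡ u + 2 * suc j * (4 * d * x)
    regroup = solve-∀

  -- that is, c m / c (j + m) < 4^-j + 1/(q+1); c-upper gives the matching lower bound 4^-j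
  c-ratio-upper : ∀ j m q → 2 * j * suc q ≤ m → c m * (suc q * 4 ^ j) < (4 ^ j + suc q) * c (j + m)
  c-ratio-upper j m q 2jq≤m = *-cancelˡ-< (suc (suc m)) _ _ (begin-strict
    suc (suc m) * (c m * (suc q * D))
      ≡⟨ shuffle (suc (suc m)) (c m) q D ⟩
    suc q * (suc (suc m) * (D * c m))
      ≤⟨ *-monoʳ-≤ (suc q) (c-lower j m) ⟩
    suc q * (suc (suc m) * c t + 2 * j * (D * c m))
      ≡⟨ distribute (suc (suc m)) (c t) q j (D * c m) ⟩
    suc (suc m) * suc q * c t + 2 * j * suc q * (D * c m)
      ≤⟨ +-monoʳ-≤ (suc (suc m) * suc q * c t) (*-monoʳ-≤ (2 * j * suc q) (*-monoʳ-≤ D (c-mono-+ j m))) ⟩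
    suc (suc m) * suc q * c t + 2 * j * suc q * (D * c t)
      <⟨ +-monoʳ-< (suc (suc m) * suc q * c t) (*-monoˡ-< (D * c t) {{>-nonZero D*ct>0}} (s≤s (m≤n⇒m≤1+n 2jq≤m))) ⟩
    suc (suc m) * suc q * c t + suc (suc m) * (D * c t)
      ≡⟨ collect (suc (suc m)) q (c t) D ⟩
    suc (suc m) * ((D + suc q) * c t) ∎)
    where
    open ≤-Reasoning
    D = 4 ^ j
    t = j + m
    D*ct>0 : 0 < D * c t
    D*ct>0 = *-mono-≤ (m^n>0 4 j) (c-positive t)
    shuffle : ∀ a x q d → a * (x * (suc q * d)) ≡ suc q * (a * (d * x))
    shuffle = solve-∀
    distribute : ∀ a y q j e → suc q * (a * y + 2 * j * e) ≡ a * suc q * y + 2 * j * suc q * e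
    distribute = solve-∀
    collect : ∀ a q y d → a * suc q * y + a * (d * y) ≡ a * ((d + suc q) * y)
    collect = solve-∀

  shifted-ratio⟶fourInv : ∀ j (g : ℕ → ℚ) → (∀ m → g (j + m) ≡ ratio (c m) (c (j + m))) → g ⟶ fourInv j
  shifted-ratio⟶fourInv j g g≡ ε 0<ε with toℚᵘ-positive ε 0<ε
  ... | p , q , ε≡ = j + 2 * j * suc q , close
    where
    close : ∀ n → j + 2 * j * suc q ≤ n → ℚ.∣ g n ℚ.- fourInv j ∣ ℚ.< ε
    close n N≤n with m≤n⇒∃[o]m+o≡n (≤-trans (m≤m+n j (2 * j * suc q)) N≤n)
    ... | m , refl = subst (λ v → ℚ.∣ v ℚ.- fourInv j ∣ ℚ.< ε) (sym (g≡ m))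
      (ratio-close (c m) (c (j + m)) (4 ^ j) p q ε ε≡ (c-positive (j + m)) (m^n>0 4 j)
        (≤-trans (c-upper j m) (≤-reflexive (*-comm (4 ^ j) (c m))))
        (c-ratio-upper j m q (+-cancelˡ-≤ j _ _ N≤n)))

T-not⇒¬T : ∀ {b} → T (not b) → ¬ T b
T-not⇒¬T {false} _ ()

¬T⇒T-not : ∀ {b} → ¬ T b → T (not b)
¬T⇒T-not {true}  ¬t = ¬t _
¬T⇒T-not {false} _  = _

memᵇ⇒∈ : ∀ x l → T (memᵇ x l) → x ∈ l
memᵇ⇒∈ x (y ∷ l) t with x ≡ᵇ y in eq
... | true  = here (≡ᵇ⇒≡ x y (subst T (sym eq) _))
... | false = there (memᵇ⇒∈ x l t)

∈⇒memᵇ : ∀ x l → x ∈ l → T (memᵇ x l)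
∈⇒memᵇ x (y ∷ l) x∈ with x ≡ᵇ y in eq
∈⇒memᵇ x (y ∷ l) x∈          | true  = _
∈⇒memᵇ x (x ∷ l) (here refl) | false = ⊥-elim (subst T eq (≡⇒≡ᵇ x x refl))
∈⇒memᵇ x (y ∷ l) (there x∈)  | false = ∈⇒memᵇ x l x∈

distinct⇒Unique : ∀ l → T (distinct l) → Unique l
distinct⇒Unique []      _ = []
distinct⇒Unique (x ∷ l) t =
  let x∉l , l-distinct = Equivalence.to T-∧ t
  in All.¬Any⇒All¬ l (T-not⇒¬T x∉l ∘ ∈⇒memᵇ x l) ∷ distinct⇒Unique l l-distinct

Unique⇒distinct : ∀ l → Unique l → T (distinct l)
Unique⇒distinct []      _           = _
Unique⇒distinct (x ∷ l) (x∉l ∷ l!) =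
  Equivalence.from T-∧ (¬T⇒T-not (All.All¬⇒¬Any x∉l ∘ memᵇ⇒∈ x l) , Unique⇒distinct l l!)

data Pair (b c : ℕ) : List ℕ → Set where
  hd : ∀ {l} → c ∈ l → Pair b c (b ∷ l)
  tl : ∀ {x l} → Pair b c l → Pair b c (x ∷ l)

data Triple (a b c : ℕ) : List ℕ → Set where
  hd : ∀ {l} → Pair b c l → Triple a b c (a ∷ l)
  tl : ∀ {x l} → Triple a b c l → Triple a b c (x ∷ l)

∈-pairs⁻ : ∀ l {b c} → (b , c) ∈ pairs l → Pair b c l
∈-pairs⁻ (x ∷ l) bc∈ with ∈-++⁻ (map (x ,_) l) bc∈
... | inj₂ bc∈′ = tl (∈-pairs⁻ l bc∈′)
... | inj₁ bc∈′ with ∈-map⁻ (x ,_) bc∈′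
...   | _ , c∈ , refl = hd c∈

∈-pairs⁺ : ∀ l {b c} → Pair b c l → (b , c) ∈ pairs l
∈-pairs⁺ (x ∷ l) (hd c∈) = ∈-++⁺ˡ (∈-map⁺ (x ,_) c∈)
∈-pairs⁺ (x ∷ l) (tl p)  = ∈-++⁺ʳ (map (x ,_) l) (∈-pairs⁺ l p)

∈-triples⁻ : ∀ l {a b c} → (a , b , c) ∈ triples l → Triple a b c l
∈-triples⁻ (x ∷ l) abc∈ with ∈-++⁻ (map (λ { (b , c) → x , b , c }) (pairs l)) abc∈
... | inj₂ abc∈′ = tl (∈-triples⁻ l abc∈′)
... | inj₁ abc∈′ with ∈-map⁻ (λ { (b , c) → x , b , c }) abc∈′
...   | _ , bc∈ , refl = hd (∈-pairs⁻ l bc∈)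

∈-triples⁺ : ∀ l {a b c} → Triple a b c l → (a , b , c) ∈ triples l
∈-triples⁺ (x ∷ l) (hd p) = ∈-++⁺ˡ (∈-map⁺ (λ { (b , c) → x , b , c }) (∈-pairs⁺ l p))
∈-triples⁺ (x ∷ l) (tl t) = ∈-++⁺ʳ (map (λ { (b , c) → x , b , c }) (pairs l)) (∈-triples⁺ l t)

Avoids231 : List ℕ → Set
Avoids231 σ = ∀ {a b c} → Triple a b c σ → ¬ (c < a × a < b)

avoids231⇒Avoids231 : ∀ σ → T (avoids231 σ) → Avoids231 σ
avoids231⇒Avoids231 σ t abc (c<a , a<b) =
  T-not⇒¬T (All.lookup (All.all⁺ _ (triples σ) t) (∈-triples⁺ σ abc)) (Equivalence.from T-∧ (<⇒<ᵇ c<a , <⇒<ᵇ a<b))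

Avoids231⇒avoids231 : ∀ σ → Avoids231 σ → T (avoids231 σ)
Avoids231⇒avoids231 σ av = All.all⁻ _ {xs = triples σ} (All.tabulate λ { {a , b , c} abc∈ → ¬T⇒T-not λ t →
  let c<a , a<b = Equivalence.to T-∧ t in av (∈-triples⁻ σ abc∈) (<ᵇ⇒< c a c<a , <ᵇ⇒< a b a<b) })

InRange : ℕ → ℕ → Set
InRange n x = 0 < x × x ≤ n

lists-suc : ∀ n m → lists n (suc m) ≡ cartesianProductWith _∷_ (map suc (upTo n)) (lists n m)
lists-suc n m = concatMap≡cartesianProductWith (map suc (upTo n))
  where
  concatMap≡cartesianProductWith : ∀ hs → concatMap (λ v → map (v ∷_) (lists n m)) hs ≡ cartesianProductWith _∷_ hs (lists n m)
  concatMap≡cartesianProductWith []       = refl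
  concatMap≡cartesianProductWith (h ∷ hs) = cong (map (h ∷_) (lists n m) ++_) (concatMap≡cartesianProductWith hs)

∈-lists⁻ : ∀ n m {σ} → σ ∈ lists n m → length σ ≡ m × All (InRange n) σ
∈-lists⁻ n zero    (here refl) = refl , []
∈-lists⁻ n (suc m) σ∈ with ∈-cartesianProductWith⁻ _∷_ (map suc (upTo n)) (lists n m) (subst (_ ∈_) (lists-suc n m) σ∈)
... | x , σ′ , x∈ , σ′∈ , refl with ∈-map⁻ suc x∈ | ∈-lists⁻ n m σ′∈
...   | i , i∈ , refl | length≡ , in-range = cong suc length≡ , (s≤s z≤n , ∈-upTo⁻ i∈) ∷ in-range

∈-lists⁺ : ∀ n m {σ} → length σ ≡ m → All (InRange n) σ → σ ∈ lists n m
∈-lists⁺ n zero    {[]}        refl []                  = here refl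
∈-lists⁺ n (suc m) {suc i ∷ σ} length≡ ((_ , i<n) ∷ in-range) =
  subst (_ ∈_) (sym (lists-suc n m))
    (∈-cartesianProductWith⁺ _∷_ (∈-map⁺ suc (∈-upTo⁺ i<n)) (∈-lists⁺ n m (suc-injective length≡) in-range))

lists-unique : ∀ n m → Unique (lists n m)
lists-unique n zero    = [] ∷ []
lists-unique n (suc m) = subst Unique (sym (lists-suc n m))
  (Unique.cartesianProductWith⁺ _∷_ ∷-injective (Unique.map⁺ suc-injective (Unique.upTo⁺ n)) (lists-unique n m))

record IsAv (n : ℕ) (σ : List ℕ) : Set where
  constructor isAv
  field
    length≡   : length σ ≡ n
    in-range  : All (InRange n) σ
    unique    : Unique σ
    avoids    : Avoids231 σ

∈-Av⁻ : ∀ n {σ} → σ ∈ Av n → IsAv n σ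
∈-Av⁻ n {σ} σ∈ with ∈-filter⁻ (T? ∘ (λ σ → distinct σ ∧ avoids231 σ)) {xs = lists n n} σ∈
... | σ∈lists , t with Equivalence.to (T-∧ {distinct σ}) t | ∈-lists⁻ n n σ∈lists
...   | d , a | length≡ , in-range = isAv length≡ in-range (distinct⇒Unique σ d) (avoids231⇒Avoids231 σ a)

∈-Av⁺ : ∀ n {σ} → IsAv n σ → σ ∈ Av n
∈-Av⁺ n {σ} (isAv length≡ in-range σ! av) =
  ∈-filter⁺ (T? ∘ (λ σ → distinct σ ∧ avoids231 σ)) (∈-lists⁺ n n length≡ in-range)
    (Equivalence.from T-∧ (Unique⇒distinct σ σ! , Avoids231⇒avoids231 σ av))

Av-unique : ∀ n → Unique (Av n)
Av-unique n = Unique.filter⁺ (T? ∘ (λ σ → distinct σ ∧ avoids231 σ)) (lists-unique n n)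

∈-Av⇒length : ∀ {n σ} → σ ∈ Av n → length σ ≡ n
∈-Av⇒length {n} = IsAv.length≡ ∘ ∈-Av⁻ n

module _ {A : Set} where

  ∈⇒remove : ∀ {x : A} {ys} → x ∈ ys → ∃ λ zs → length ys ≡ suc (length zs) × (∀ {z} → z ∈ ys → z ≢ x → z ∈ zs)
  ∈⇒remove {ys = y ∷ ys} (here refl) = ys , refl , λ { (here z≡x) z≢x → ⊥-elim (z≢x z≡x) ; (there z∈) _ → z∈ }
  ∈⇒remove {ys = y ∷ ys} (there x∈) with ∈⇒remove x∈
  ... | zs , length≡ , keep = y ∷ zs , cong suc length≡ , λ { (here z≡y) _ → here z≡y ; (there z∈) z≢x → there (keep z∈ z≢x) }

  Unique-⊆⇒length-≤ : ∀ {xs ys : List A} → Unique xs → (∀ {z} → z ∈ xs → z ∈ ys) → length xs ≤ length ys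
  Unique-⊆⇒length-≤ {[]}     _            _  = z≤n
  Unique-⊆⇒length-≤ {x ∷ xs} (x∉xs ∷ xs!) xs⊆ys with ∈⇒remove (xs⊆ys (here refl))
  ... | zs , length≡ , keep = subst (suc (length xs) ≤_) (sym length≡)
    (s≤s (Unique-⊆⇒length-≤ xs! λ z∈ → keep (xs⊆ys (there z∈)) λ { refl → All.All¬⇒¬Any x∉xs z∈ }))

  length-≡-via-map : ∀ {B : Set} (f : B → A) {xs : List A} {ys : List B} → Unique xs → Unique ys →
                     (∀ {x y} → x ∈ ys → y ∈ ys → f x ≡ f y → x ≡ y) →
                     (∀ {z} → z ∈ xs → z ∈ map f ys) → (∀ {z} → z ∈ map f ys → z ∈ xs) →
                     length xs ≡ length ys
  length-≡-via-map f {xs} {ys} xs! ys! f-injective xs⊆ f[ys]⊆ = trans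
    (≤-antisym (Unique-⊆⇒length-≤ xs! xs⊆) (Unique-⊆⇒length-≤ (map-unique ys ys! f-injective) f[ys]⊆))
    (length-map f ys)
    where
    map-unique : ∀ ys → Unique ys → (∀ {x y} → x ∈ ys → y ∈ ys → f x ≡ f y → x ≡ y) → Unique (map f ys)
    map-unique []       _            _  = []
    map-unique (y ∷ ys) (y∉ys ∷ ys!) inj =
      All.map⁺ (All.tabulate λ x∈ fy≡fx → All.lookup y∉ys x∈ (inj (here refl) (there x∈) fy≡fx))
        ∷ map-unique ys ys! (λ x∈ y∈ → inj (there x∈) (there y∈))

interval-pigeonhole : ∀ lo m {l} → Unique l → All (λ x → lo < x × x ≤ lo + m) l → length l ≤ m
interval-pigeonhole lo m {l} l! in-interval = subst (length l ≤_) (trans (length-map _ (upTo m)) (length-upTo m))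
  (Unique-⊆⇒length-≤ l! λ z∈ → in-image (All.lookup in-interval z∈))
  where
  in-image : ∀ {z} → lo < z × z ≤ lo + m → z ∈ map (λ t → lo + suc t) (upTo m)
  in-image {suc z} (lo<z , z≤lo+m) = subst (_∈ map (λ t → lo + suc t) (upTo m)) lo+[z-lo]≡z
    (∈-map⁺ (λ t → lo + suc t) (∈-upTo⁺ (+-cancelˡ-< lo _ _ (subst (_< lo + m) (sym (m+[n∸m]≡n (≤-pred lo<z))) z≤lo+m))))
    where
    lo+[z-lo]≡z : lo + suc (z ∸ lo) ≡ suc z
    lo+[z-lo]≡z = trans (+-suc lo _) (cong suc (m+[n∸m]≡n (≤-pred lo<z)))

Pair⇒∈₁ : ∀ {b c l} → Pair b c l → b ∈ l
Pair⇒∈₁ (hd _) = here refl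
Pair⇒∈₁ (tl p) = there (Pair⇒∈₁ p)

Pair⇒∈₂ : ∀ {b c l} → Pair b c l → c ∈ l
Pair⇒∈₂ (hd c∈) = there c∈
Pair⇒∈₂ (tl p)  = there (Pair⇒∈₂ p)

Pair-++⁻ : ∀ l {r b c} → Pair b c (l ++ r) → Pair b c l ⊎ (b ∈ l × c ∈ r) ⊎ Pair b c r
Pair-++⁻ []      p = inj₂ (inj₂ p)
Pair-++⁻ (x ∷ l) (hd c∈) with ∈-++⁻ l c∈
... | inj₁ c∈l = inj₁ (hd c∈l)
... | inj₂ c∈r = inj₂ (inj₁ (here refl , c∈r))
Pair-++⁻ (x ∷ l) (tl p) with Pair-++⁻ l p
... | inj₁ q                 = inj₁ (tl q)
... | inj₂ (inj₁ (b∈ , c∈)) = inj₂ (inj₁ (there b∈ , c∈))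
... | inj₂ (inj₂ q)          = inj₂ (inj₂ q)

Triple-++⁻ : ∀ l {r a b c} → Triple a b c (l ++ r) →
             Triple a b c l ⊎ (Pair a b l × c ∈ r) ⊎ (a ∈ l × Pair b c r) ⊎ Triple a b c r
Triple-++⁻ []      t = inj₂ (inj₂ (inj₂ t))
Triple-++⁻ (x ∷ l) (hd p) with Pair-++⁻ l p
... | inj₁ q                 = inj₁ (hd q)
... | inj₂ (inj₁ (b∈ , c∈)) = inj₂ (inj₁ (hd b∈ , c∈))
... | inj₂ (inj₂ q)          = inj₂ (inj₂ (inj₁ (here refl , q)))
Triple-++⁻ (x ∷ l) (tl t) with Triple-++⁻ l t
... | inj₁ q                        = inj₁ (tl q)
... | inj₂ (inj₁ (p , c∈))         = inj₂ (inj₁ (tl p , c∈))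
... | inj₂ (inj₂ (inj₁ (a∈ , p))) = inj₂ (inj₂ (inj₁ (there a∈ , p)))
... | inj₂ (inj₂ (inj₂ q))         = inj₂ (inj₂ (inj₂ q))

Pair-map⁻ : ∀ f l {b c} → Pair b c (map f l) → ∃₂ λ b′ c′ → Pair b′ c′ l × b ≡ f b′ × c ≡ f c′
Pair-map⁻ f (x ∷ l) (hd c∈) with ∈-map⁻ f c∈
... | y , y∈ , refl = x , y , hd y∈ , refl , refl
Pair-map⁻ f (x ∷ l) (tl p) with Pair-map⁻ f l p
... | b′ , c′ , q , b≡ , c≡ = b′ , c′ , tl q , b≡ , c≡

Triple-map⁻ : ∀ f l {a b c} → Triple a b c (map f l) → ∃₂ λ a′ b′ → ∃ λ c′ → Triple a′ b′ c′ l × a ≡ f a′ × b ≡ f b′ × c ≡ f c′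
Triple-map⁻ f (x ∷ l) (hd p) with Pair-map⁻ f l p
... | b′ , c′ , q , refl , refl = x , b′ , c′ , hd q , refl , refl , refl
Triple-map⁻ f (x ∷ l) (tl t) with Triple-map⁻ f l t
... | a′ , b′ , c′ , q , eqs = a′ , b′ , c′ , tl q , eqs

Pair-map⁺ : ∀ f {l b c} → Pair b c l → Pair (f b) (f c) (map f l)
Pair-map⁺ f (hd c∈) = hd (∈-map⁺ f c∈)
Pair-map⁺ f (tl p)  = tl (Pair-map⁺ f p)

Triple-map⁺ : ∀ f {l a b c} → Triple a b c l → Triple (f a) (f b) (f c) (map f l)
Triple-map⁺ f (hd p) = hd (Pair-map⁺ f p)
Triple-map⁺ f (tl t) = tl (Triple-map⁺ f t)

Pair-++⁺ˡ : ∀ {l} r {b c} → Pair b c l → Pair b c (l ++ r)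
Pair-++⁺ˡ r (hd c∈) = hd (∈-++⁺ˡ c∈)
Pair-++⁺ˡ r (tl p)  = tl (Pair-++⁺ˡ r p)

Pair-++⁺ʳ : ∀ l {r b c} → Pair b c r → Pair b c (l ++ r)
Pair-++⁺ʳ []      p = p
Pair-++⁺ʳ (x ∷ l) p = tl (Pair-++⁺ʳ l p)

Triple-++⁺ˡ : ∀ {l} r {a b c} → Triple a b c l → Triple a b c (l ++ r)
Triple-++⁺ˡ r (hd p) = hd (Pair-++⁺ˡ r p)
Triple-++⁺ˡ r (tl t) = tl (Triple-++⁺ˡ r t)

Triple-++⁺ʳ : ∀ l {r a b c} → Triple a b c r → Triple a b c (l ++ r)
Triple-++⁺ʳ []      t = t
Triple-++⁺ʳ (x ∷ l) t = tl (Triple-++⁺ʳ l t)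

Triple-across : ∀ l {m r x y} → x ∈ l → y ∈ r → Triple x m y (l ++ m ∷ r)
Triple-across (x ∷ l) (here refl) y∈ = hd (Pair-++⁺ʳ l (hd y∈))
Triple-across (_ ∷ l) (there x∈)  y∈ = tl (Triple-across l x∈ y∈)

length-⊕1⊖ : ∀ τ π → length (τ ⊕ (one ⊖ π)) ≡ length τ + suc (length π)
length-⊕1⊖ τ π = trans (length-++ τ) (cong (λ k → length τ + suc k) (length-map (length τ +_) π))

shift-in-range : ∀ i {j π} → All (InRange j) π → All (λ y → i < y × y ≤ i + j) (map (i +_) π)
shift-in-range i []                 = []
shift-in-range i ((0<y , y≤j) ∷ rs) = (m<m+n i 0<y , +-monoʳ-≤ i y≤j) ∷ shift-in-range i rs

IsAv-⊕1⊖ : ∀ {i j τ π} → IsAv i τ → IsAv j π → IsAv (i + suc j) (τ ⊕ (one ⊖ π))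
IsAv-⊕1⊖ {τ = τ} {π} (isAv refl τ-range τ! τ-av) (isAv refl π-range π! π-av) =
  isAv (length-⊕1⊖ τ π) range (Unique.++⁺ τ! (top∉R ∷ Unique.map⁺ (+-cancelˡ-≡ i _ _) π!) τ⊥top∷R) avoids
  where
  i = length τ
  j = length π
  top = i + (j + 1)
  R = map (i +_) π
  top≡ : top ≡ i + suc j
  top≡ = cong (i +_) (+-comm j 1)
  R-range = shift-in-range i π-range
  τ≤i : ∀ {x} → x ∈ τ → x ≤ i
  τ≤i x∈ = proj₂ (All.lookup τ-range x∈)
  i<top∷R : ∀ {y} → y ∈ top ∷ R → i < y
  i<top∷R (here refl) = subst (i <_) (sym top≡) (m<m+n i z<s)
  i<top∷R (there y∈)  = proj₁ (All.lookup R-range y∈)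
  R<top : ∀ {y} → y ∈ R → y < top
  R<top {y} y∈ = subst (y <_) (sym (trans top≡ (+-suc i j))) (s≤s (proj₂ (All.lookup R-range y∈)))
  top∉R : All (top ≢_) R
  top∉R = All.tabulate λ y∈ top≡y → <-irrefl (sym top≡y) (R<top y∈)
  τ⊥top∷R : ∀ {x} → ¬ (x ∈ τ × x ∈ top ∷ R)
  τ⊥top∷R (x∈τ , x∈R) = <-irrefl refl (≤-<-trans (τ≤i x∈τ) (i<top∷R x∈R))
  range : All (InRange (i + suc j)) (τ ++ top ∷ R)
  range = All.++⁺ (All.map (λ { (0<x , x≤i) → 0<x , ≤-trans x≤i (m≤m+n i (suc j)) }) τ-range)
            ((≤-trans z<s (i<top∷R (here refl)) , ≤-reflexive top≡) ∷
             All.map (λ { (i<y , y≤i+j) → ≤-trans z<s i<y , ≤-trans y≤i+j (+-monoʳ-≤ i (n≤1+n j)) }) R-range)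
  avoids : Avoids231 (τ ++ top ∷ R)
  avoids t (c<a , a<b) with Triple-++⁻ τ t
  ... | inj₁ t′                        = τ-av t′ (c<a , a<b)
  ... | inj₂ (inj₁ (p , c∈))          = <-asym c<a (≤-<-trans (τ≤i (Pair⇒∈₁ p)) (i<top∷R c∈))
  ... | inj₂ (inj₂ (inj₁ (a∈ , p)))  = <-asym c<a (≤-<-trans (τ≤i a∈) (i<top∷R (Pair⇒∈₂ p)))
  ... | inj₂ (inj₂ (inj₂ (hd p)))     = <-asym a<b (R<top (Pair⇒∈₁ p))
  ... | inj₂ (inj₂ (inj₂ (tl t′))) with Triple-map⁻ (i +_) π t′
  ...   | _ , _ , _ , t″ , refl , refl , refl = π-av t″ (+-cancelˡ-< i _ _ c<a , +-cancelˡ-< i _ _ a<b)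

Unique-++⁻ : ∀ {A : Set} (xs : List A) {ys} → Unique (xs ++ ys) → Unique xs × Unique ys × (∀ {v} → v ∈ xs → v ∉ ys)
Unique-++⁻ []       ys!           = [] , ys! , λ ()
Unique-++⁻ (x ∷ xs) (x∉xs++ys ∷ xs++ys!) with Unique-++⁻ xs xs++ys!
... | xs! , ys! , xs⊥ys = All.++⁻ˡ xs x∉xs++ys ∷ xs! , ys! , λ
  { (here refl) v∈ys → All.lookup (All.++⁻ʳ xs x∉xs++ys) v∈ys refl
  ; (there v∈xs) v∈ys → xs⊥ys v∈xs v∈ys }

record Decomposition (n : ℕ) (σ : List ℕ) : Set where
  constructor decomposition
  field
    τ π   : List ℕ
    τ-av  : IsAv (length τ) τ
    π-av  : IsAv (length π) π
    sizes : length τ + length π ≡ n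
    σ≡    : σ ≡ τ ⊕ (one ⊖ π)

≤-suc-≢ : ∀ {v n} → v ≤ suc n → v ≢ suc n → v ≤ n
≤-suc-≢ v≤1+n v≢1+n = ≤-pred (≤∧≢⇒< v≤1+n v≢1+n)

module SplitAtMaximum {n} (L R : List ℕ) (σ-av : IsAv (suc n) (L ++ suc n ∷ R)) where
  open IsAv σ-av

  private
    i = length L
    j = length R
    parts = Unique-++⁻ L unique
    L!  = proj₁ parts
    R!  = AllPairs.tail (proj₁ (proj₂ parts))
    L⊥top∷R = proj₂ (proj₂ parts)

  i+j≡n : i + j ≡ n
  i+j≡n = suc-injective (trans (sym (+-suc i j)) (trans (sym (length-++ L)) length≡))

  L≤n : ∀ {x} → x ∈ L → x ≤ n
  L≤n x∈ = ≤-suc-≢ (proj₂ (All.lookup in-range (∈-++⁺ˡ x∈))) λ x≡ → L⊥top∷R x∈ (here x≡)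

  R≤n : ∀ {y} → y ∈ R → y ≤ n
  R≤n y∈ = ≤-suc-≢ (proj₂ (All.lookup in-range (∈-++⁺ʳ L (there y∈))))
             λ y≡ → All.lookup (AllPairs.head (proj₁ (proj₂ parts))) y∈ (sym y≡)

  -- were y < x, then x (suc n) y would be an occurrence of 231
  L<R : ∀ {x y} → x ∈ L → y ∈ R → x < y
  L<R x∈ y∈ = ≤∧≢⇒< (≮⇒≥ λ y<x → avoids (Triple-across L x∈ y∈) (y<x , s≤s (L≤n x∈)))
                     λ { refl → L⊥top∷R x∈ (there y∈) }

  L≤i : ∀ {x} → x ∈ L → x ≤ i
  L≤i {x} x∈ = +-cancelʳ-≤ j x i (begin
    x + j        ≡⟨ +-comm x j ⟩
    j + x        ≤⟨ +-monoˡ-≤ x j≤n-x ⟩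
    (n ∸ x) + x  ≡⟨ m∸n+n≡m (L≤n x∈) ⟩
    n            ≡⟨ i+j≡n ⟨
    i + j        ∎)
    where
    open ≤-Reasoning
    j≤n-x : j ≤ n ∸ x
    j≤n-x = interval-pigeonhole x (n ∸ x) R! (All.tabulate λ {y} y∈ →
      L<R x∈ y∈ , subst (y ≤_) (sym (m+[n∸m]≡n (L≤n x∈))) (R≤n y∈))

  i<R : ∀ {y} → y ∈ R → i < y
  i<R {suc y} y∈ = s≤s (interval-pigeonhole 0 y L! (All.tabulate λ x∈ →
    proj₁ (All.lookup in-range (∈-++⁺ˡ x∈)) , ≤-pred (L<R x∈ y∈)))
  i<R {zero}  y∈ = ⊥-elim (<-irrefl refl (proj₁ (All.lookup in-range (∈-++⁺ʳ L (there y∈)))))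

  π : List ℕ
  π = map (_∸ i) R

  shift-π : map (i +_) π ≡ R
  shift-π = unshift R (All.tabulate i<R)
    where
    unshift : ∀ ys → All (i <_) ys → map (i +_) (map (_∸ i) ys) ≡ ys
    unshift []       []           = refl
    unshift (y ∷ ys) (i<y ∷ i<ys) = cong₂ _∷_ (m+[n∸m]≡n (<⇒≤ i<y)) (unshift ys i<ys)

  length-π : length π ≡ j
  length-π = length-map (_∸ i) R

  L-av : IsAv i L
  L-av = isAv refl (All.tabulate λ x∈ → proj₁ (All.lookup in-range (∈-++⁺ˡ x∈)) , L≤i x∈) L!
              (λ t → avoids (Triple-++⁺ˡ (suc n ∷ R) t))

  π-av : IsAv (length π) π
  π-av = isAv refl (All.tabulate π-in-range) (Unique.map⁻ (subst Unique (sym shift-π) R!))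
    λ t (c<a , a<b) → avoids (Triple-++⁺ʳ L (tl (subst (Triple _ _ _) shift-π (Triple-map⁺ (i +_) t))))
                             (+-monoʳ-< i c<a , +-monoʳ-< i a<b)
    where
    π-in-range : ∀ {z} → z ∈ π → InRange (length π) z
    π-in-range z∈ with ∈-map⁻ (_∸ i) z∈
    ... | y , y∈ , refl = m<n⇒0<n∸m (i<R y∈) ,
      subst (y ∸ i ≤_) (sym length-π) (m≤n+o⇒m∸n≤o y i (subst (y ≤_) (sym i+j≡n) (R≤n y∈)))

  sizes : i + length π ≡ n
  sizes = trans (cong (i +_) length-π) i+j≡n

  σ≡ : L ++ suc n ∷ R ≡ L ⊕ (one ⊖ π)
  σ≡ = cong (L ++_) (cong₂ _∷_ top≡ (sym shift-π))
    where
    top≡ : suc n ≡ i + (length π + 1)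
    top≡ = trans (sym (trans (+-suc i (length π)) (cong suc sizes))) (cong (i +_) (+-comm 1 (length π)))

max∈ : ∀ {n σ} → IsAv (suc n) σ → suc n ∈ σ
max∈ {n} {σ} (isAv length≡ in-range σ! _) with suc n ∈? σ
... | yes top∈ = top∈
... | no  top∉ = ⊥-elim (1+n≰n (subst (_≤ n) length≡ (interval-pigeonhole 0 n σ! (All.tabulate λ x∈ →
  proj₁ (All.lookup in-range x∈) , ≤-suc-≢ (proj₂ (All.lookup in-range x∈)) λ { refl → top∉ x∈ }))))

decompose : ∀ {n σ} → IsAv (suc n) σ → Decomposition n σ
decompose σ-av with ∈-∃++ (max∈ σ-av)
... | L , R , refl = decomposition L π L-av π-av sizes σ≡
  where open SplitAtMaximum L R σ-av

∈-prefix : ∀ {A : Set} (l₁ l₂ : List A) {r₁ r₂ x} → l₁ ++ x ∷ r₁ ≡ l₂ ++ r₂ → length l₁ < length l₂ → x ∈ l₂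
∈-prefix []       (y ∷ l₂) eq _          = here (∷-injectiveˡ eq)
∈-prefix (_ ∷ l₁) (_ ∷ l₂) eq (s≤s l₁<l₂) = there (∈-prefix l₁ l₂ (∷-injectiveʳ eq) l₁<l₂)

++-injective : ∀ {A : Set} (l₁ l₂ : List A) {r₁ r₂} → l₁ ++ r₁ ≡ l₂ ++ r₂ → length l₁ ≡ length l₂ → l₁ ≡ l₂ × r₁ ≡ r₂
++-injective []       []       eq _ = refl , eq
++-injective (x ∷ l₁) (y ∷ l₂) eq length≡ with ∷-injective eq
... | refl , eq′ with ++-injective l₁ l₂ eq′ (suc-injective length≡)
...   | refl , r≡ = refl , r≡

-- the maximum of τ ⊕ (1 ⊖ π) sits at position |τ|, and it cannot lie inside a shorter permutation τ′
⊕1⊖-prefix-≮ : ∀ {τ π τ′ π′} → IsAv (length τ′) τ′ → τ ⊕ (one ⊖ π) ≡ τ′ ⊕ (one ⊖ π′) → ¬ (length τ < length τ′)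
⊕1⊖-prefix-≮ {τ} {π} {τ′} {π′} τ′-av eq τ<τ′ = <-irrefl refl (begin-strict
  top                             ≤⟨ proj₂ (All.lookup (IsAv.in-range τ′-av) (∈-prefix τ τ′ eq τ<τ′)) ⟩
  length τ′                       <⟨ m<m+n (length τ′) z<s ⟩
  length τ′ + suc (length π′)     ≡⟨ trans (sym (length-⊕1⊖ τ′ π′)) (cong length (sym eq)) ⟩
  length (τ ⊕ (one ⊖ π))          ≡⟨ trans (length-⊕1⊖ τ π) (cong (length τ +_) (+-comm 1 (length π))) ⟩
  top                             ∎)
  where
  open ≤-Reasoning
  top = length τ + (length π + 1)

⊕1⊖-injective : ∀ {τ π τ′ π′} → IsAv (length τ) τ → IsAv (length τ′) τ′ →
                τ ⊕ (one ⊖ π) ≡ τ′ ⊕ (one ⊖ π′) → τ ≡ τ′ × π ≡ π′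
⊕1⊖-injective {τ} {π} {τ′} τ-av τ′-av eq
  with ++-injective τ τ′ eq (≤-antisym (≮⇒≥ (⊕1⊖-prefix-≮ τ-av (sym eq))) (≮⇒≥ (⊕1⊖-prefix-≮ τ′-av eq)))
... | refl , rest = refl , map-injective (+-cancelˡ-≡ (length τ) _ _) (∷-injectiveʳ rest)

module _ {A B : Set} where

  length-cartesianProduct : ∀ (xs : List A) (ys : List B) → length (cartesianProduct xs ys) ≡ length xs * length ys
  length-cartesianProduct []       ys = refl
  length-cartesianProduct (x ∷ xs) ys =
    trans (length-++ (map (x ,_) ys)) (cong₂ _+_ (length-map (x ,_) ys) (length-cartesianProduct xs ys))

  sizedPairs : (ℕ → List A) → (ℕ → List B) → ℕ → List (A × B)
  sizedPairs f g zero    = cartesianProduct (f 0) (g 0)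
  sizedPairs f g (suc n) = cartesianProduct (f 0) (g (suc n)) ++ sizedPairs (f ∘ suc) g n

  length-sizedPairs : ∀ f g n → length (sizedPairs f g n) ≡ ((length ∘ f) ⋆ (length ∘ g)) n
  length-sizedPairs f g zero    = length-cartesianProduct (f 0) (g 0)
  length-sizedPairs f g (suc n) = trans (length-++ (cartesianProduct (f 0) (g (suc n))))
    (cong₂ _+_ (length-cartesianProduct (f 0) (g (suc n))) (length-sizedPairs (f ∘ suc) g n))

  ∈-sizedPairs⁺ : ∀ f g a b {x y} → x ∈ f a → y ∈ g b → (x , y) ∈ sizedPairs f g (a + b)
  ∈-sizedPairs⁺ f g zero    zero    x∈ y∈ = ∈-cartesianProduct⁺ x∈ y∈
  ∈-sizedPairs⁺ f g zero    (suc b) x∈ y∈ = ∈-++⁺ˡ (∈-cartesianProduct⁺ x∈ y∈)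
  ∈-sizedPairs⁺ f g (suc a) b       x∈ y∈ = ∈-++⁺ʳ (cartesianProduct (f 0) _) (∈-sizedPairs⁺ (f ∘ suc) g a b x∈ y∈)

  ∈-sizedPairs⁻ : ∀ f g n {x y} → (x , y) ∈ sizedPairs f g n → ∃₂ λ a b → a + b ≡ n × x ∈ f a × y ∈ g b
  ∈-sizedPairs⁻ f g zero    xy∈ = 0 , 0 , refl , ∈-cartesianProduct⁻ (f 0) (g 0) xy∈
  ∈-sizedPairs⁻ f g (suc n) xy∈ with ∈-++⁻ (cartesianProduct (f 0) (g (suc n))) xy∈
  ... | inj₁ xy∈′ = 0 , suc n , refl , ∈-cartesianProduct⁻ (f 0) (g (suc n)) xy∈′
  ... | inj₂ xy∈′ with ∈-sizedPairs⁻ (f ∘ suc) g n xy∈′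
  ...   | a , b , a+b≡n , x∈ , y∈ = suc a , b , cong suc a+b≡n , x∈ , y∈

  sizedPairs-unique : ∀ f g → (∀ a → Unique (f a)) → (∀ b → Unique (g b)) →
                      (∀ {x a a′} → x ∈ f a → x ∈ f a′ → a ≡ a′) → ∀ n → Unique (sizedPairs f g n)
  sizedPairs-unique f g f! g! f-disjoint zero    = Unique.cartesianProduct⁺ (f! 0) (g! 0)
  sizedPairs-unique f g f! g! f-disjoint (suc n) =
    Unique.++⁺ (Unique.cartesianProduct⁺ (f! 0) (g! (suc n)))
      (sizedPairs-unique (f ∘ suc) g (f! ∘ suc) g! (λ x∈ x∈′ → suc-injective (f-disjoint x∈ x∈′)) n)
      disjoint
    where
    disjoint : ∀ {v} → ¬ (v ∈ cartesianProduct (f 0) (g (suc n)) × v ∈ sizedPairs (f ∘ suc) g n)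
    disjoint {x , y} (xy∈ , xy∈′) with ∈-sizedPairs⁻ (f ∘ suc) g n xy∈′
    ... | _ , _ , _ , x∈ , _ with f-disjoint (proj₁ (∈-cartesianProduct⁻ (f 0) (g (suc n)) xy∈)) x∈
    ... | ()

#Av : ℕ → ℕ
#Av n = length (Av n)

#Av-suc : ∀ n → #Av (suc n) ≡ (#Av ⋆ #Av) n
#Av-suc n = trans
  (length-≡-via-map glue (Av-unique (suc n)) (sizedPairs-unique Av Av Av-unique Av-unique Av-size-unique n)
    glue-injective decomposed glued)
  (length-sizedPairs Av Av n)
  where
  glue : List ℕ × List ℕ → List ℕ
  glue (τ , π) = τ ⊕ (one ⊖ π)
  Av-size-unique : ∀ {σ a a′} → σ ∈ Av a → σ ∈ Av a′ → a ≡ a′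
  Av-size-unique σ∈ σ∈′ = trans (sym (∈-Av⇒length σ∈)) (∈-Av⇒length σ∈′)
  IsAv-length : ∀ a {σ} → σ ∈ Av a → IsAv (length σ) σ
  IsAv-length a σ∈ = subst (λ k → IsAv k _) (sym (∈-Av⇒length σ∈)) (∈-Av⁻ a σ∈)
  glue-injective : ∀ {x y} → x ∈ sizedPairs Av Av n → y ∈ sizedPairs Av Av n → glue x ≡ glue y → x ≡ y
  glue-injective {τ , π} {τ′ , π′} x∈ y∈ eq with ∈-sizedPairs⁻ Av Av n x∈ | ∈-sizedPairs⁻ Av Av n y∈
  ... | a , _ , _ , τ∈ , _ | a′ , _ , _ , τ′∈ , _ with ⊕1⊖-injective (IsAv-length a τ∈) (IsAv-length a′ τ′∈) eq
  ...   | refl , refl = refl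
  decomposed : ∀ {σ} → σ ∈ Av (suc n) → σ ∈ map glue (sizedPairs Av Av n)
  decomposed {σ} σ∈ with decompose (∈-Av⁻ (suc n) σ∈)
  ... | decomposition τ π τ-av π-av refl refl = ∈-map⁺ glue (∈-sizedPairs⁺ Av Av (length τ) (length π) (∈-Av⁺ _ τ-av) (∈-Av⁺ _ π-av))
  glued : ∀ {σ} → σ ∈ map glue (sizedPairs Av Av n) → σ ∈ Av (suc n)
  glued σ∈ with ∈-map⁻ glue σ∈
  ... | (τ , π) , τπ∈ , refl with ∈-sizedPairs⁻ Av Av n τπ∈
  ...   | a , b , refl , τ∈ , π∈ =
    ∈-Av⁺ (suc (a + b)) (subst (λ k → IsAv k (glue (τ , π))) (+-suc a b) (IsAv-⊕1⊖ (∈-Av⁻ a τ∈) (∈-Av⁻ b π∈)))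

T-==⇒≡ : ∀ σ σ′ → T (σ == σ′) → σ ≡ σ′
T-==⇒≡ σ σ′ = toWitness {a? = ≡-dec _≟_ σ σ′}

∈-AvUpTo⁻ : ∀ L {π} → π ∈ AvUpTo L → ∃ λ j → π ∈ Av j
∈-AvUpTo⁻ L π∈ with find (∈-concatMap⁻ Av {xs = upTo (suc L)} π∈)
... | j , _ , π∈Av = j , π∈Av

∈-AvUpTo⁺ : ∀ {L j π} → j ≤ L → π ∈ Av j → π ∈ AvUpTo L
∈-AvUpTo⁺ {L} j≤L π∈ = ∈-concatMap⁺ Av {xs = upTo (suc L)} (lose (∈-upTo⁺ (s≤s j≤L)) π∈)

-- tauIs ρ and piIs ρ are inImage for f π = ρ ⊕ (one ⊖ π) and f τ = τ ⊕ (one ⊖ ρ) respectively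
module ImageCount (k : ℕ) (f : List ℕ → List ℕ)
                  (f-injective : ∀ {x y} → f x ≡ f y → x ≡ y)
                  (length-f : ∀ π → length (f π) ≡ suc k + length π)
                  (f-Av : ∀ j {π} → π ∈ Av j → f π ∈ Av (suc k + j)) where

  inImage : List ℕ → Bool
  inImage σ = any (λ π → σ == f π) (AvUpTo (length σ))

  image-count : ∀ m → length (filterᵇ inImage (Av (suc k + m))) ≡ #Av m
  image-count m = length-≡-via-map f (Unique.filter⁺ (T? ∘ inImage) (Av-unique (suc k + m))) (Av-unique m)
                    (λ _ _ → f-injective) preimage image
    where
    preimage : ∀ {σ} → σ ∈ filterᵇ inImage (Av (suc k + m)) → σ ∈ map f (Av m)
    preimage {σ} σ∈ with ∈-filter⁻ (T? ∘ inImage) {xs = Av (suc k + m)} σ∈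
    ... | σ∈Av , t with find (Any.any⁻ _ (AvUpTo (length σ)) t)
    ...   | π , π∈ , σ==fπ with T-==⇒≡ σ (f π) σ==fπ | ∈-AvUpTo⁻ (length σ) π∈
    ...     | refl | j , π∈Av = subst (λ i → f π ∈ map f (Av i)) j≡m (∈-map⁺ f π∈Av)
      where
      j≡m : j ≡ m
      j≡m = +-cancelˡ-≡ (suc k) j m (begin
        suc k + j           ≡⟨ cong (suc k +_) (∈-Av⇒length π∈Av) ⟨
        suc k + length π    ≡⟨ length-f π ⟨
        length (f π)        ≡⟨ ∈-Av⇒length σ∈Av ⟩
        suc k + m           ∎)
        where open ≡-Reasoning
    image : ∀ {σ} → σ ∈ map f (Av m) → σ ∈ filterᵇ inImage (Av (suc k + m))
    image σ∈ with ∈-map⁻ f σ∈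
    ... | π , π∈ , refl = ∈-filter⁺ (T? ∘ inImage) (f-Av m π∈)
      (Any.any⁺ _ (lose (∈-AvUpTo⁺ m≤length π∈) (fromWitness {a? = ≡-dec _≟_ (f π) (f π)} refl)))
      where
      m≤length : m ≤ length (f π)
      m≤length = subst (m ≤_) (sym (∈-Av⇒length (f-Av m π∈))) (m≤n+m m (suc k))

tauIs-count : ∀ k {ρ} → ρ ∈ Av k → ∀ m → length (filterᵇ (tauIs ρ) (Av (suc k + m))) ≡ #Av m
tauIs-count k {ρ} ρ∈ = ImageCount.image-count k (λ π → ρ ⊕ (one ⊖ π)) injective length≡ closed
  where
  ρ-av = ∈-Av⁻ k ρ∈
  injective : ∀ {π π′} → ρ ⊕ (one ⊖ π) ≡ ρ ⊕ (one ⊖ π′) → π ≡ π′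
  injective eq = map-injective (+-cancelˡ-≡ (length ρ) _ _) (∷-injectiveʳ (proj₂ (++-injective ρ ρ eq refl)))
  length≡ : ∀ π → length (ρ ⊕ (one ⊖ π)) ≡ suc k + length π
  length≡ π = trans (length-⊕1⊖ ρ π) (trans (cong (_+ suc (length π)) (IsAv.length≡ ρ-av)) (+-suc k (length π)))
  closed : ∀ j {π} → π ∈ Av j → ρ ⊕ (one ⊖ π) ∈ Av (suc k + j)
  closed j {π} π∈ = ∈-Av⁺ (suc k + j) (subst (λ i → IsAv i (ρ ⊕ (one ⊖ π))) (+-suc k j) (IsAv-⊕1⊖ ρ-av (∈-Av⁻ j π∈)))

piIs-count : ∀ k {ρ} → ρ ∈ Av k → ∀ m → length (filterᵇ (piIs ρ) (Av (suc k + m))) ≡ #Av m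
piIs-count k {ρ} ρ∈ = ImageCount.image-count k (λ τ → τ ⊕ (one ⊖ ρ)) injective length≡ closed
  where
  ρ-av = ∈-Av⁻ k ρ∈
  length≡ : ∀ τ → length (τ ⊕ (one ⊖ ρ)) ≡ suc k + length τ
  length≡ τ = trans (length-⊕1⊖ τ ρ) (trans (cong (λ i → length τ + suc i) (IsAv.length≡ ρ-av)) (+-comm (length τ) (suc k)))
  injective : ∀ {τ τ′} → τ ⊕ (one ⊖ ρ) ≡ τ′ ⊕ (one ⊖ ρ) → τ ≡ τ′
  injective {τ} {τ′} eq = proj₁ (++-injective τ τ′ eq
    (+-cancelˡ-≡ (suc k) _ _ (trans (sym (length≡ τ)) (trans (cong length eq) (length≡ τ′)))))
  closed : ∀ j {τ} → τ ∈ Av j → τ ⊕ (one ⊖ ρ) ∈ Av (suc k + j)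
  closed j {τ} τ∈ = ∈-Av⁺ (suc k + j) (subst (λ i → IsAv i (τ ⊕ (one ⊖ ρ))) (+-comm j (suc k)) (IsAv-⊕1⊖ (∈-Av⁻ j τ∈) ρ-av))

lemma3p7 : ∀ (k : ℕ) (ρ : List ℕ) → ρ ∈ Av k →
    ((λ n → prob (tauIs ρ) n) ⟶ fourInv (suc k)) × ((λ n → prob (piIs ρ) n) ⟶ fourInv (suc k))
lemma3p7 k ρ ρ∈ =
  shifted-ratio⟶fourInv (suc k) (prob (tauIs ρ)) (λ m → cong (λ x → ratio x (#Av (suc k + m))) (tauIs-count k ρ∈ m)) ,
  shifted-ratio⟶fourInv (suc k) (prob (piIs ρ)) (λ m → cong (λ x → ratio x (#Av (suc k + m))) (piIs-count k ρ∈ m))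
  where open CatalanRecursion #Av refl #Av-suc
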